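{- For each $n$, let $N=N(n)=\lceil 3n\log_2 n\rceil$ and color each element of the Boolean lattice $Q_N$ red or blue independently and uniformly at random (each color with probability $1/2$). Then the probability that this coloring contains a copy of $Q_n$ all of whose elements have the same color tends to $1$ as $n\to\infty$.
   Context: $Q_N$ denotes the Boolean lattice of dimension $N$: the power set $2^{[N]}$ ordered by inclusion. A copy of a poset $P$ in a poset $P'$ is the image of an injective map $f$ with $x\leq y$ in $P$ iff $f(x)\leq f(y)$ in $P'$. -}

module Defs where

open import Data.Nat using (ℕ; _*_; _^_)
open import Data.Nat.Logarithm using (⌈log₂_⌉)
open import Data.Bool using (Bool)
open import Data.Fin.Subset using (Subset; _⊆_)
open import Data.Product using (Σ; _×_; ∃)
open import Function.Bundles using (_⇔_)
open import Function.Definitions using (Injective)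
open import Relation.Binary.PropositionalEquality using (_≡_; _≢_)

-- N(n) = ⌈ 3 n log₂ n ⌉ = ⌈ log₂ (n ^ (3n)) ⌉  (since 3n log₂ n = log₂ (n^(3n)))
Ndim : ℕ → ℕ
Ndim n = ⌈log₂ (n ^ (3 * n)) ⌉

Coloring : ℕ → Set
Coloring N = Subset N → Bool

IsCopy : (n N : ℕ) → (Subset n → Subset N) → Set
IsCopy n N f = Injective _≡_ _≡_ f × (∀ x y → (x ⊆ y) ⇔ (f x ⊆ f y))

HasMonoCopy : (n : ℕ) {N : ℕ} → Coloring N → Set
HasMonoCopy n {N} c =
  Σ (Subset n → Subset N) λ f → IsCopy n N f × ∃ λ b → ∀ x → c (f x) ≡ b

Differ : {N : ℕ} → Coloring N → Coloring N → Set
Differ c c' = ∃ λ x → c x ≢ c' x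

-- Split the coordinates of Q_N into a copy of Q_n followed by n + 1 blocks of m ≈ log₂ n
-- coordinates (and padding). To x ∈ Q_n attach the m-dimensional subcube {x} × S_∣x∣, where S_r
-- has its first r blocks full, block r free and the rest empty; every point of S_r lies below
-- every point of S_r′ when r < r′. So if each of these 2ⁿ disjoint subcubes contains a red (true) point
-- y_x, then x ↦ x ∪ y_x is a red copy of Q_n. A subcube contains no red point with probability
-- 2^(-2^m), hence all of them do with probability at least (1 - 2^(-2^m))^(2ⁿ) ≥ 1 - 2ⁿ/2^(2^m),
-- which tends to 1. The probabilities are obtained by explicitly listing the colourings.
module Submission where

open import Defs
open import Data.Bool using (true; false)
open import Data.Fin.Subset using (Subset; Side; inside; outside; _⊆_; _⊂_; ∣_∣)
open import Data.Fin.Subset.Properties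
  using (out⊆; in⊆in; out⊂; in⊂in; out⊂in; drop-∷-⊆; ⊆-refl; ⊆⊤; ⊥⊆; p⊂q⇒∣p∣<∣q∣; ∣p∣≤n)
open import Data.List using (List; []; _∷_; _++_; map; length; cartesianProductWith)
open import Data.List.Properties using (length-++; length-map)
open import Data.List.Relation.Unary.All as All using (All; []; _∷_)
import Data.List.Relation.Unary.All.Properties as All
open import Data.List.Relation.Unary.AllPairs as AllPairs using (AllPairs; []; _∷_)
import Data.List.Relation.Unary.AllPairs.Properties as AllPairs
open import Data.Maybe using (Maybe; just; nothing)
open import Data.Nat
open import Data.Nat.Logarithm using (⌈log₂_⌉; ⌈log₂⌉-mono-≤; ⌈log₂2^n⌉≡n)
open import Data.Nat.Properties
open import Algebra.Properties.CommutativeSemigroup *-commutativeSemigroup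
  using (interchange; xy∙z≈xz∙y; xy∙z≈zx∙y)
open import Data.Nat.Tactic.RingSolver using (solve-∀)
open import Data.Product using (Σ; ∃; _×_; _,_; proj₁; proj₂)
open import Data.Sum using (_⊎_; inj₁; inj₂)
open import Data.Vec using (Vec; []; _∷_; replicate; here) renaming (_++_ to _++ᵥ_)
open import Data.Vec.Properties using (++-injectiveˡ)
open import Function using (_∘_; const)
open import Function.Bundles using (mk⇔)
open import Level using (Level)
open import Relation.Binary using (Rel)
open import Relation.Binary.PropositionalEquality
open import Relation.Nullary using (yes; no; contradiction)

private
  variable
    ℓ₁ ℓ₂ ℓ₃ : Level
    M m n : ℕ

2^2^-suc : ∀ n → 2 ^ 2 ^ suc n ≡ 2 ^ 2 ^ n * 2 ^ 2 ^ n
2^2^-suc n = begin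
  2 ^ (2 ^ n + (2 ^ n + 0)) ≡⟨ cong (λ e → 2 ^ (2 ^ n + e)) (+-identityʳ (2 ^ n)) ⟩
  2 ^ (2 ^ n + 2 ^ n)       ≡⟨ ^-distribˡ-+-* 2 (2 ^ n) (2 ^ n) ⟩
  2 ^ 2 ^ n * 2 ^ 2 ^ n     ∎
  where open ≡-Reasoning

n<2^n : ∀ n → n < 2 ^ n
n<2^n zero    = s≤s z≤n
n<2^n (suc n) = +-mono-≤ (m^n>0 2 n) (≤-trans (n<2^n n) (m≤m+n (2 ^ n) 0))

binary-magnitude : ∀ n → 0 < n → ∃ λ ℓ → 2 ^ ℓ ≤ n × n < 2 ^ suc ℓ
binary-magnitude (suc zero)    _ = 0 , ≤-refl , s≤s (s≤s z≤n)
binary-magnitude (suc (suc n)) _ with binary-magnitude (suc n) (s≤s z≤n)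
... | ℓ , 2^ℓ≤n , n<2^1+ℓ with suc (suc n) <? 2 ^ suc ℓ
...   | yes n<2^1+ℓ′ = ℓ , m≤n⇒m≤1+n 2^ℓ≤n , n<2^1+ℓ′
...   | no  n≮2^1+ℓ′ = suc ℓ , ≮⇒≥ n≮2^1+ℓ′ ,
                       ≤-<-trans n<2^1+ℓ (^-monoʳ-< 2 (s≤s (s≤s z≤n)) (n<1+n (suc ℓ)))

module _ {a b c : Level} {A : Set a} {B : Set b} {C : Set c} (f : A → B → C) where

  length-cartesianProductWith : ∀ (xs : List A) ys →
    length (cartesianProductWith f xs ys) ≡ length xs * length ys
  length-cartesianProductWith []       ys = refl
  length-cartesianProductWith (x ∷ xs) ys = begin
    length (map (f x) ys ++ cartesianProductWith f xs ys)
      ≡⟨ length-++ (map (f x) ys) ⟩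
    length (map (f x) ys) + length (cartesianProductWith f xs ys)
      ≡⟨ cong₂ _+_ (length-map (f x) ys) (length-cartesianProductWith xs ys) ⟩
    length ys + length xs * length ys ∎
    where open ≡-Reasoning

  All-cartesianProductWith⁺ : ∀ {P : A → Set ℓ₁} {Q : B → Set ℓ₂} {R : C → Set ℓ₃} {xs ys} →
    (∀ {x y} → P x → Q y → R (f x y)) → All P xs → All Q ys →
    All R (cartesianProductWith f xs ys)
  All-cartesianProductWith⁺ {xs = xs} {ys} pres Pxs Qys =
    All.cartesianProductWith⁺ (setoid A) (setoid B) f xs ys
      λ x∈xs y∈ys → pres (All.lookup Pxs x∈xs) (All.lookup Qys y∈ys)

  AllPairs-cartesianProductWith⁺ : ∀ {R : Rel A ℓ₁} {S : Rel B ℓ₂} {T : Rel C ℓ₃} {xs ys} →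
    (∀ {x x′ y y′} → R x x′ → T (f x y) (f x′ y′)) →
    (∀ {x y y′} → S y y′ → T (f x y) (f x y′)) →
    AllPairs R xs → AllPairs S ys → AllPairs T (cartesianProductWith f xs ys)
  AllPairs-cartesianProductWith⁺ presˡ presʳ [] Sys = []
  AllPairs-cartesianProductWith⁺ {xs = _ ∷ xs} {ys} presˡ presʳ (Rx ∷ Rxs) Sys =
    AllPairs.++⁺ (AllPairs.map⁺ (AllPairs.map presʳ Sys))
      (AllPairs-cartesianProductWith⁺ presˡ presʳ Rxs Sys)
      (All.map⁺ (All.tabulate λ _ → All.cartesianProductWith⁺ (setoid A) (setoid B) f xs ys
        λ x′∈xs _ → presˡ (All.lookup Rx x′∈xs)))

glue : Coloring M → Coloring M → Coloring (suc M)
glue c₀ c₁ (outside ∷ x) = c₀ x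
glue c₀ c₁ (inside  ∷ x) = c₁ x

glue-Differˡ : ∀ {c₀ c₀′ c₁ c₁′ : Coloring M} → Differ c₀ c₀′ → Differ (glue c₀ c₁) (glue c₀′ c₁′)
glue-Differˡ (x , c₀x≢c₀′x) = outside ∷ x , c₀x≢c₀′x

glue-Differʳ : ∀ {c₀ c₀′ c₁ c₁′ : Coloring M} → Differ c₁ c₁′ → Differ (glue c₀ c₁) (glue c₀′ c₁′)
glue-Differʳ (x , c₁x≢c₁′x) = inside ∷ x , c₁x≢c₁′x

infixr 6 _⊗_
_⊗_ : List (Coloring M) → List (Coloring M) → List (Coloring (suc M))
_⊗_ = cartesianProductWith glue

length-⊗ : ∀ (cs ds : List (Coloring M)) → length (cs ⊗ ds) ≡ length cs * length ds
length-⊗ = length-cartesianProductWith glue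

All-⊗⁺ : ∀ {P Q : Coloring M → Set} {R : Coloring (suc M) → Set} {cs ds} →
  (∀ {c d} → P c → Q d → R (glue c d)) → All P cs → All Q ds → All R (cs ⊗ ds)
All-⊗⁺ = All-cartesianProductWith⁺ glue

All-⊗ˡ⁺ : ∀ {P : Coloring M → Set} {R : Coloring (suc M) → Set} {cs} ds →
  (∀ {c d} → P c → R (glue c d)) → All P cs → All R (cs ⊗ ds)
All-⊗ˡ⁺ {cs = cs} ds pres Pcs =
  All.cartesianProductWith⁺ (setoid _) (setoid _) glue cs ds λ c∈cs _ → pres (All.lookup Pcs c∈cs)

All-⊗ʳ⁺ : ∀ {Q : Coloring M → Set} {R : Coloring (suc M) → Set} cs {ds} →
  (∀ {c d} → Q d → R (glue c d)) → All Q ds → All R (cs ⊗ ds)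
All-⊗ʳ⁺ cs {ds} pres Qds =
  All.cartesianProductWith⁺ (setoid _) (setoid _) glue cs ds λ _ d∈ds → pres (All.lookup Qds d∈ds)

Differ-⊗⁺ : ∀ {cs ds : List (Coloring M)} →
  AllPairs Differ cs → AllPairs Differ ds → AllPairs Differ (cs ⊗ ds)
Differ-⊗⁺ = AllPairs-cartesianProductWith⁺ glue glue-Differˡ glue-Differʳ

allColorings : ∀ M → List (Coloring M)
allColorings zero    = const false ∷ const true ∷ []
allColorings (suc M) = allColorings M ⊗ allColorings M

length-allColorings : ∀ M → length (allColorings M) ≡ 2 ^ 2 ^ M
length-allColorings zero    = refl
length-allColorings (suc M) = begin
  length (allColorings M ⊗ allColorings M)              ≡⟨ length-⊗ (allColorings M) (allColorings M) ⟩
  length (allColorings M) * length (allColorings M)     ≡⟨ cong₂ _*_ (length-allColorings M) (length-allColorings M) ⟩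
  2 ^ 2 ^ M * 2 ^ 2 ^ M                                 ≡⟨ sym (2^2^-suc M) ⟩
  2 ^ 2 ^ suc M                                         ∎
  where open ≡-Reasoning

allColorings-distinct : ∀ M → AllPairs Differ (allColorings M)
allColorings-distinct zero    = ((([] , λ ())) ∷ []) ∷ [] ∷ []
allColorings-distinct (suc M) = Differ-⊗⁺ (allColorings-distinct M) (allColorings-distinct M)

Subcube : ℕ → Set
Subcube M = Vec (Maybe Side) M

infix 4 _∈ₛ_
data _∈ₛ_ : Subset M → Subcube M → Set where
  []    : [] ∈ₛ []
  fixed : ∀ {s x} {p : Subcube M} → x ∈ₛ p → s ∷ x ∈ₛ just s ∷ p
  free  : ∀ {s x} {p : Subcube M} → x ∈ₛ p → s ∷ x ∈ₛ nothing ∷ p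

dim : Subcube M → ℕ
dim []            = 0
dim (just _ ∷ p)  = dim p
dim (nothing ∷ p) = suc (dim p)

Hits : Subcube M → Coloring M → Set
Hits p c = ∃ λ x → x ∈ₛ p × c x ≡ true

Avoids : Subcube M → Coloring M → Set
Avoids p c = ∀ x → x ∈ₛ p → c x ≡ false

Hits∧Avoids⇒Differ : ∀ {p : Subcube M} {c d} → Hits p c → Avoids p d → Differ c d
Hits∧Avoids⇒Differ (x , x∈p , cx≡true) d-avoids =
  x , λ cx≡dx → contradiction (trans (sym cx≡true) (trans cx≡dx (d-avoids x x∈p))) λ ()

hitting avoiding : Subcube M → List (Coloring M)
hitting []                  = const true ∷ []
hitting (just outside ∷ p)  = hitting p ⊗ allColorings _
hitting (just inside  ∷ p)  = allColorings _ ⊗ hitting p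
-- either the outside half hits p, or it avoids p and the inside half hits p
hitting (nothing      ∷ p)  = hitting p ⊗ allColorings _ ++ avoiding p ⊗ hitting p
avoiding []                 = const false ∷ []
avoiding (just outside ∷ p) = avoiding p ⊗ allColorings _
avoiding (just inside  ∷ p) = allColorings _ ⊗ avoiding p
avoiding (nothing      ∷ p) = avoiding p ⊗ avoiding p

hitting-hits : ∀ (p : Subcube M) → All (Hits p) (hitting p)
avoiding-avoids : ∀ (p : Subcube M) → All (Avoids p) (avoiding p)
hitting-hits []                 = ([] , [] , refl) ∷ []
hitting-hits (just outside ∷ p) =
  All-⊗ˡ⁺ (allColorings _) (λ { (x , x∈p , hit) → outside ∷ x , fixed x∈p , hit }) (hitting-hits p)
hitting-hits (just inside  ∷ p) =
  All-⊗ʳ⁺ (allColorings _) (λ { (x , x∈p , hit) → inside ∷ x , fixed x∈p , hit }) (hitting-hits p)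
hitting-hits (nothing      ∷ p) = All.++⁺
  (All-⊗ˡ⁺ (allColorings _) (λ { (x , x∈p , hit) → outside ∷ x , free x∈p , hit }) (hitting-hits p))
  (All-⊗ʳ⁺ (avoiding p) (λ { (x , x∈p , hit) → inside ∷ x , free x∈p , hit }) (hitting-hits p))
avoiding-avoids []                 = (λ { [] [] → refl }) ∷ []
avoiding-avoids (just outside ∷ p) =
  All-⊗ˡ⁺ (allColorings _) (λ { avoids (_ ∷ x) (fixed x∈p) → avoids x x∈p }) (avoiding-avoids p)
avoiding-avoids (just inside  ∷ p) =
  All-⊗ʳ⁺ (allColorings _) (λ { avoids (_ ∷ x) (fixed x∈p) → avoids x x∈p }) (avoiding-avoids p)
avoiding-avoids (nothing      ∷ p) = All-⊗⁺
  (λ { avoids₀ _ (outside ∷ x) (free x∈p) → avoids₀ x x∈p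
     ; _ avoids₁ (inside  ∷ x) (free x∈p) → avoids₁ x x∈p })
  (avoiding-avoids p) (avoiding-avoids p)

hitting-distinct : ∀ (p : Subcube M) → AllPairs Differ (hitting p)
avoiding-distinct : ∀ (p : Subcube M) → AllPairs Differ (avoiding p)
hitting-distinct []                 = [] ∷ []
hitting-distinct (just outside ∷ p) = Differ-⊗⁺ (hitting-distinct p) (allColorings-distinct _)
hitting-distinct (just inside  ∷ p) = Differ-⊗⁺ (allColorings-distinct _) (hitting-distinct p)
hitting-distinct (nothing      ∷ p) = AllPairs.++⁺
  (Differ-⊗⁺ (hitting-distinct p) (allColorings-distinct _))
  (Differ-⊗⁺ (avoiding-distinct p) (hitting-distinct p))
  (All-⊗ˡ⁺ (allColorings _)
    (λ c-hits → All-⊗ˡ⁺ (hitting p) (λ d-avoids → glue-Differˡ (Hits∧Avoids⇒Differ c-hits d-avoids))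
                         (avoiding-avoids p))
    (hitting-hits p))
avoiding-distinct []                 = [] ∷ []
avoiding-distinct (just outside ∷ p) = Differ-⊗⁺ (avoiding-distinct p) (allColorings-distinct _)
avoiding-distinct (just inside  ∷ p) = Differ-⊗⁺ (allColorings-distinct _) (avoiding-distinct p)
avoiding-distinct (nothing      ∷ p) = Differ-⊗⁺ (avoiding-distinct p) (avoiding-distinct p)

length-hitting+avoiding : ∀ (p : Subcube M) → length (hitting p) + length (avoiding p) ≡ 2 ^ 2 ^ M
length-hitting+avoiding []                           = refl
length-hitting+avoiding {suc M} (just outside ∷ p)
  rewrite length-⊗ (hitting p) (allColorings M) | length-⊗ (avoiding p) (allColorings M)
        | length-allColorings M | 2^2^-suc M
  = trans (sym (*-distribʳ-+ (2 ^ 2 ^ M) (length (hitting p)) (length (avoiding p))))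
          (cong (_* 2 ^ 2 ^ M) (length-hitting+avoiding p))
length-hitting+avoiding {suc M} (just inside  ∷ p)
  rewrite length-⊗ (allColorings M) (hitting p) | length-⊗ (allColorings M) (avoiding p)
        | length-allColorings M | 2^2^-suc M
  = trans (sym (*-distribˡ-+ (2 ^ 2 ^ M) (length (hitting p)) (length (avoiding p))))
          (cong (2 ^ 2 ^ M *_) (length-hitting+avoiding p))
length-hitting+avoiding {suc M} (nothing      ∷ p)
  rewrite length-++ (hitting p ⊗ allColorings M) {avoiding p ⊗ hitting p}
        | length-⊗ (hitting p) (allColorings M) | length-⊗ (avoiding p) (hitting p)
        | length-⊗ (avoiding p) (avoiding p) | length-allColorings M | 2^2^-suc M
  = begin
    g * D + b * g + b * b   ≡⟨ +-assoc (g * D) (b * g) (b * b) ⟩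
    g * D + (b * g + b * b) ≡⟨ cong (g * D +_) (sym (*-distribˡ-+ b g b)) ⟩
    g * D + b * (g + b)     ≡⟨ cong (λ e → g * D + b * e) (length-hitting+avoiding p) ⟩
    g * D + b * D           ≡⟨ sym (*-distribʳ-+ D g b) ⟩
    (g + b) * D             ≡⟨ cong (_* D) (length-hitting+avoiding p) ⟩
    D * D                   ∎
  where
  open ≡-Reasoning
  g = length (hitting p)
  b = length (avoiding p)
  D = 2 ^ 2 ^ M

length-avoiding : ∀ (p : Subcube M) → length (avoiding p) * 2 ^ 2 ^ dim p ≡ 2 ^ 2 ^ M
length-avoiding []                           = refl
length-avoiding {suc M} (just outside ∷ p)
  rewrite length-⊗ (avoiding p) (allColorings M) | length-allColorings M | 2^2^-suc M
  = trans (xy∙z≈xz∙y (length (avoiding p)) (2 ^ 2 ^ M) (2 ^ 2 ^ dim p))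
          (cong (_* 2 ^ 2 ^ M) (length-avoiding p))
length-avoiding {suc M} (just inside  ∷ p)
  rewrite length-⊗ (allColorings M) (avoiding p) | length-allColorings M | 2^2^-suc M
  = trans (*-assoc (2 ^ 2 ^ M) (length (avoiding p)) (2 ^ 2 ^ dim p))
          (cong (2 ^ 2 ^ M *_) (length-avoiding p))
length-avoiding {suc M} (nothing      ∷ p)
  rewrite length-⊗ (avoiding p) (avoiding p) | 2^2^-suc M | 2^2^-suc (dim p)
  = trans (interchange b b F F) (cong₂ _*_ (length-avoiding p) (length-avoiding p))
  where
  b = length (avoiding p)
  F = 2 ^ 2 ^ dim p

length-hitting : ∀ (p : Subcube M) → length (hitting p) * 2 ^ 2 ^ dim p ≡ (2 ^ 2 ^ dim p ∸ 1) * 2 ^ 2 ^ M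
length-hitting {M} p = sym (begin
  (F ∸ 1) * D               ≡⟨ *-distribʳ-∸ D F 1 ⟩
  F * D ∸ 1 * D             ≡⟨ cong₂ _∸_ (*-comm F D) (*-identityˡ D) ⟩
  D * F ∸ D                 ≡⟨ cong₂ (λ d e → d * F ∸ e) (sym (length-hitting+avoiding p)) (sym (length-avoiding p)) ⟩
  (g + b) * F ∸ b * F       ≡⟨ cong (_∸ b * F) (*-distribʳ-+ F g b) ⟩
  g * F + b * F ∸ b * F     ≡⟨ m+n∸n≡m (g * F) (b * F) ⟩
  g * F                     ∎)
  where
  open ≡-Reasoning
  g = length (hitting p)
  b = length (avoiding p)
  F = 2 ^ 2 ^ dim p
  D = 2 ^ 2 ^ M

hittingEach : ∀ n → (Subset n → Subcube M) → List (Coloring (n + M))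
hittingEach zero    φ = hitting (φ [])
hittingEach (suc n) φ = hittingEach n (φ ∘ (outside ∷_)) ⊗ hittingEach n (φ ∘ (inside ∷_))

HitsEach : (Subset n → Subcube M) → Coloring (n + M) → Set
HitsEach φ c = ∀ x → Hits (φ x) (c ∘ (x ++ᵥ_))

hittingEach-hits : ∀ n (φ : Subset n → Subcube M) → All (HitsEach φ) (hittingEach n φ)
hittingEach-hits zero    φ = All.map (λ { hits [] → hits }) (hitting-hits (φ []))
hittingEach-hits (suc n) φ = All-⊗⁺
  (λ { hits₀ _ (outside ∷ x) → hits₀ x ; _ hits₁ (inside ∷ x) → hits₁ x })
  (hittingEach-hits n _) (hittingEach-hits n _)

hittingEach-distinct : ∀ n (φ : Subset n → Subcube M) → AllPairs Differ (hittingEach n φ)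
hittingEach-distinct zero    φ = hitting-distinct (φ [])
hittingEach-distinct (suc n) φ = Differ-⊗⁺ (hittingEach-distinct n _) (hittingEach-distinct n _)

monus-double-≤-square : ∀ e c → e * (e ∸ (c + c)) ≤ (e ∸ c) * (e ∸ c)
monus-double-≤-square e c with ≤-total e (c + c)
... | inj₁ e≤2c rewrite m≤n⇒m∸n≡0 e≤2c | *-zeroʳ e = z≤n
... | inj₂ 2c≤e with m≤n⇒∃[o]m+o≡n 2c≤e
...   | u , refl = begin
  (c + c + u) * (c + c + u ∸ (c + c)) ≡⟨ cong ((c + c + u) *_) (m+n∸m≡n (c + c) u) ⟩
  (c + c + u) * u                     ≤⟨ m≤m+n _ (c * c) ⟩
  (c + c + u) * u + c * c             ≡⟨ square-expansion c u ⟩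
  (c + u) * (c + u)                   ≡⟨ cong (λ v → v * v) (sym c+c+u∸c≡c+u) ⟩
  (c + c + u ∸ c) * (c + c + u ∸ c)   ∎
  where
  open ≤-Reasoning
  square-expansion : ∀ c u → (c + c + u) * u + c * c ≡ (c + u) * (c + u)
  square-expansion = solve-∀
  c+c+u∸c≡c+u : c + c + u ∸ c ≡ c + u
  c+c+u∸c≡c+u = trans (cong (_∸ c) (+-assoc c c u)) (m+n∸m≡n c (c + u))

-- Bernoulli's inequality (1 - c/e)² ≥ 1 - 2c/e, cleared of denominators.
product-bound : ∀ e c T g h →
  (e ∸ c) * T ≤ g * e → (e ∸ c) * T ≤ h * e → (e ∸ (c + c)) * (T * T) ≤ g * h * e
product-bound zero c T g h _ _ rewrite 0∸n≡0 (c + c) = z≤n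
product-bound e@(suc _) c T g h g-bound h-bound = *-cancelʳ-≤ _ _ e (begin
  (e ∸ (c + c)) * (T * T) * e     ≡⟨ xy∙z≈zx∙y (e ∸ (c + c)) (T * T) e ⟩
  e * (e ∸ (c + c)) * (T * T)     ≤⟨ *-monoˡ-≤ (T * T) (monus-double-≤-square e c) ⟩
  (e ∸ c) * (e ∸ c) * (T * T)     ≡⟨ interchange (e ∸ c) (e ∸ c) T T ⟩
  (e ∸ c) * T * ((e ∸ c) * T)     ≤⟨ *-mono-≤ g-bound h-bound ⟩
  g * e * (h * e)                 ≡⟨ interchange g e h e ⟩
  g * h * (e * e)                 ≡⟨ *-assoc (g * h) e e ⟨
  g * h * e * e                   ∎)
  where open ≤-Reasoning

length-hittingEach : ∀ {m} n (φ : Subset n → Subcube M) → (∀ x → dim (φ x) ≡ m) →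
  (2 ^ 2 ^ m ∸ 2 ^ n) * 2 ^ 2 ^ (n + M) ≤ length (hittingEach n φ) * 2 ^ 2 ^ m
length-hittingEach zero φ dim≡m rewrite sym (dim≡m []) = ≤-reflexive (sym (length-hitting (φ [])))
length-hittingEach {M} {m} (suc n) φ dim≡m = begin
  (e ∸ 2 ^ suc n) * 2 ^ 2 ^ suc (n + M)
    ≡⟨ cong₂ (λ t T → (e ∸ t) * T) (cong (2 ^ n +_) (+-identityʳ (2 ^ n))) (2^2^-suc (n + M)) ⟩
  (e ∸ (2 ^ n + 2 ^ n)) * (2 ^ 2 ^ (n + M) * 2 ^ 2 ^ (n + M))
    ≤⟨ product-bound e (2 ^ n) (2 ^ 2 ^ (n + M)) (length (hittingEach n φ₀)) (length (hittingEach n φ₁))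
                     (length-hittingEach n φ₀ (dim≡m ∘ (outside ∷_)))
                     (length-hittingEach n φ₁ (dim≡m ∘ (inside ∷_))) ⟩
  length (hittingEach n φ₀) * length (hittingEach n φ₁) * e
    ≡⟨ cong (_* e) (length-⊗ (hittingEach n φ₀) (hittingEach n φ₁)) ⟨
  length (hittingEach (suc n) φ) * e ∎
  where
  open ≤-Reasoning
  e = 2 ^ 2 ^ m
  φ₀ φ₁ : Subset n → Subcube M
  φ₀ = φ ∘ (outside ∷_)
  φ₁ = φ ∘ (inside ∷_)

⊆-∷-tail : ∀ {s t} {p q : Subset m} {p′ q′ : Subset n} → s ∷ p ⊆ t ∷ q → p′ ⊆ q′ → s ∷ p′ ⊆ t ∷ q′
⊆-∷-tail {s = outside}                 _     p′⊆q′ = out⊆ p′⊆q′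
⊆-∷-tail {s = inside} {t = inside}     _     p′⊆q′ = in⊆in p′⊆q′
⊆-∷-tail {s = inside} {t = outside} sp⊆tq _     = contradiction (sp⊆tq here) λ ()

⊆-++⁺ : ∀ {p p′ : Subset m} {q q′ : Subset n} → p ⊆ p′ → q ⊆ q′ → p ++ᵥ q ⊆ p′ ++ᵥ q′
⊆-++⁺ {p = []}    {[]}     _     q⊆q′ = q⊆q′
⊆-++⁺ {p = _ ∷ _} {_ ∷ _} p⊆p′ q⊆q′ = ⊆-∷-tail p⊆p′ (⊆-++⁺ (drop-∷-⊆ p⊆p′) q⊆q′)

⊆-++⁻ˡ : ∀ (p p′ : Subset m) {q q′ : Subset n} → p ++ᵥ q ⊆ p′ ++ᵥ q′ → p ⊆ p′
⊆-++⁻ˡ []      []       _         = λ ()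
⊆-++⁻ˡ (_ ∷ p) (_ ∷ p′) sp++q⊆tp′++q′ =
  ⊆-∷-tail sp++q⊆tp′++q′ (⊆-++⁻ˡ p p′ (drop-∷-⊆ sp++q⊆tp′++q′))

⊆⇒≡⊎⊂ : ∀ {p q : Subset n} → p ⊆ q → p ≡ q ⊎ p ⊂ q
⊆⇒≡⊎⊂ {p = []}          {[]}          _    = inj₁ refl
⊆⇒≡⊎⊂ {p = outside ∷ p} {outside ∷ q} p⊆q with ⊆⇒≡⊎⊂ (drop-∷-⊆ p⊆q)
... | inj₁ refl = inj₁ refl
... | inj₂ p⊂q  = inj₂ (out⊂ p⊂q)
⊆⇒≡⊎⊂ {p = outside ∷ p} {inside  ∷ q} p⊆q = inj₂ (out⊂in (drop-∷-⊆ p⊆q))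
⊆⇒≡⊎⊂ {p = inside  ∷ p} {outside ∷ q} p⊆q = contradiction (p⊆q here) λ ()
⊆⇒≡⊎⊂ {p = inside  ∷ p} {inside  ∷ q} p⊆q with ⊆⇒≡⊎⊂ (drop-∷-⊆ p⊆q)
... | inj₁ refl = inj₁ refl
... | inj₂ p⊂q  = inj₂ (in⊂in p⊂q)

Ascending : (ℕ → Subcube M) → Set
Ascending ψ = ∀ {r r′ y y′} → r < r′ → y ∈ₛ ψ r → y′ ∈ₛ ψ r′ → y ⊆ y′

HitsEach⇒HasMonoCopy : ∀ (ψ : ℕ → Subcube M) → Ascending ψ →
  (c : Coloring (n + M)) → HitsEach (ψ ∘ ∣_∣) c → HasMonoCopy n c
HitsEach⇒HasMonoCopy {n = n} ψ ascending c hits =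
  f , (f-injective , λ x x′ → mk⇔ (f-mono x x′) (⊆-++⁻ˡ x x′)) , true , λ x → proj₂ (proj₂ (hits x))
  where
  y : Subset n → Subset _
  y x = proj₁ (hits x)
  f : Subset n → Subset _
  f x = x ++ᵥ y x
  f-injective : ∀ {x x′} → f x ≡ f x′ → x ≡ x′
  f-injective {x} {x′} = ++-injectiveˡ x x′
  y-mono : ∀ x x′ → x ⊆ x′ → y x ⊆ y x′
  y-mono x x′ x⊆x′ with ⊆⇒≡⊎⊂ x⊆x′
  ... | inj₁ refl = ⊆-refl
  ... | inj₂ x⊂x′ = ascending (p⊂q⇒∣p∣<∣q∣ x⊂x′) (proj₁ (proj₂ (hits x))) (proj₁ (proj₂ (hits x′)))
  f-mono : ∀ x x′ → x ⊆ x′ → f x ⊆ f x′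
  f-mono x x′ x⊆x′ = ⊆-++⁺ x⊆x′ (y-mono x x′ x⊆x′)

allFixed : ∀ n → Side → Subcube n
allFixed n s = replicate n (just s)

allFree : ∀ n → Subcube n
allFree n = replicate n nothing

∈ₛ-allFixed : ∀ {s} {x : Subset n} → x ∈ₛ allFixed n s → x ≡ replicate n s
∈ₛ-allFixed []          = refl
∈ₛ-allFixed (fixed x∈p) = cong (_ ∷_) (∈ₛ-allFixed x∈p)

∈ₛ-++⁻ : ∀ (p : Subcube m) {q : Subcube n} {z} → z ∈ₛ p ++ᵥ q →
  ∃ λ x → ∃ λ y → z ≡ x ++ᵥ y × x ∈ₛ p × y ∈ₛ q
∈ₛ-++⁻ []      z∈q = _ , _ , refl , [] , z∈q
∈ₛ-++⁻ (_ ∷ p) (fixed z∈p++q) with ∈ₛ-++⁻ p z∈p++q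
... | x , y , refl , x∈p , y∈q = _ , y , refl , fixed x∈p , y∈q
∈ₛ-++⁻ (_ ∷ p) (free z∈p++q) with ∈ₛ-++⁻ p z∈p++q
... | x , y , refl , x∈p , y∈q = _ , y , refl , free x∈p , y∈q

dim-++ : ∀ (p : Subcube m) (q : Subcube n) → dim (p ++ᵥ q) ≡ dim p + dim q
dim-++ []            q = refl
dim-++ (just _ ∷ p)  q = dim-++ p q
dim-++ (nothing ∷ p) q = cong suc (dim-++ p q)

dim-allFixed : ∀ n {s} → dim (allFixed n s) ≡ 0
dim-allFixed zero    = refl
dim-allFixed (suc n) = dim-allFixed n

dim-allFree : ∀ n → dim (allFree n) ≡ n
dim-allFree zero    = refl
dim-allFree (suc n) = cong suc (dim-allFree n)

blocks : (m pad b : ℕ) → ℕ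
blocks m pad zero    = pad
blocks m pad (suc b) = m + blocks m pad b

blocks≡ : ∀ m pad b → blocks m pad b ≡ b * m + pad
blocks≡ m pad zero    = refl
blocks≡ m pad (suc b) = trans (cong (m +_) (blocks≡ m pad b)) (sym (+-assoc m (b * m) pad))

ladder : ∀ m pad b → ℕ → Subcube (blocks m pad b)
ladder m pad zero    r       = allFixed pad outside
ladder m pad (suc b) zero    = allFree m ++ᵥ allFixed (blocks m pad b) outside
ladder m pad (suc b) (suc r) = allFixed m inside ++ᵥ ladder m pad b r

ladder-ascending : ∀ m pad b → Ascending (ladder m pad b)
ladder-ascending m pad zero _ y∈ _ rewrite ∈ₛ-allFixed y∈ = ⊥⊆
ladder-ascending m pad (suc b) {zero} {suc r′} _ y∈ y′∈
  with ∈ₛ-++⁻ (allFree m) y∈ | ∈ₛ-++⁻ (allFixed m inside) y′∈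
... | x , y , refl , _ , y∈outside | x′ , y′ , refl , x′∈inside , _
  rewrite ∈ₛ-allFixed y∈outside | ∈ₛ-allFixed x′∈inside = ⊆-++⁺ {m = m} ⊆⊤ ⊥⊆
ladder-ascending m pad (suc b) {suc r} {suc r′} (s≤s r<r′) y∈ y′∈
  with ∈ₛ-++⁻ (allFixed m inside) y∈ | ∈ₛ-++⁻ (allFixed m inside) y′∈
... | x , y , refl , x∈inside , y∈ladder | x′ , y′ , refl , x′∈inside , y′∈ladder
  rewrite ∈ₛ-allFixed x∈inside | ∈ₛ-allFixed x′∈inside =
  ⊆-++⁺ ⊆-refl (ladder-ascending m pad b r<r′ y∈ladder y′∈ladder)

dim-ladder : ∀ m pad b {r} → r < b → dim (ladder m pad b r) ≡ m
dim-ladder m pad (suc b) {zero} _ = begin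
  dim (allFree m ++ᵥ allFixed rest outside)     ≡⟨ dim-++ (allFree m) (allFixed rest outside) ⟩
  dim (allFree m) + dim (allFixed rest outside) ≡⟨ cong₂ _+_ (dim-allFree m) (dim-allFixed rest) ⟩
  m + 0                                         ≡⟨ +-identityʳ m ⟩
  m                                             ∎
  where
  open ≡-Reasoning
  rest = blocks m pad b
dim-ladder m pad (suc b) {suc r} (s≤s r<b) =
  trans (dim-++ (allFixed m inside) (ladder m pad b r))
        (cong₂ _+_ (dim-allFixed m) (dim-ladder m pad b r<b))

-- (1 - t/e)·T colourings out of T are good, and t/e ≤ 1/(k+1).
fraction-bound : ∀ k t e T g .{{_ : NonZero e}} → suc k * t ≤ e → (e ∸ t) * T ≤ g * e → k * T ≤ suc k * g
fraction-bound k t e T g budget count = *-cancelʳ-≤ (k * T) (suc k * g) e (begin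
  k * T * e             ≡⟨ xy∙z≈xz∙y k T e ⟩
  k * e * T             ≤⟨ *-monoˡ-≤ T ke≤[k+1][e∸t] ⟩
  suc k * (e ∸ t) * T   ≡⟨ *-assoc (suc k) (e ∸ t) T ⟩
  suc k * ((e ∸ t) * T) ≤⟨ *-monoʳ-≤ (suc k) count ⟩
  suc k * (g * e)       ≡⟨ *-assoc (suc k) g e ⟨
  suc k * g * e         ∎)
  where
  open ≤-Reasoning
  ke≤[k+1][e∸t] : k * e ≤ suc k * (e ∸ t)
  ke≤[k+1][e∸t] = begin
    k * e                 ≡⟨ m+n∸m≡n e (k * e) ⟨
    suc k * e ∸ e         ≤⟨ ∸-monoʳ-≤ (suc k * e) budget ⟩
    suc k * e ∸ suc k * t ≡⟨ *-distribˡ-∸ (suc k) e t ⟨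
    suc k * (e ∸ t)       ∎

dimension-budget : ∀ {ℓ n} → 3 ≤ ℓ → suc ℓ ≤ n → n + suc n * (2 + ℓ) ≤ ℓ * (3 * n)
dimension-budget 3≤ℓ ℓ<n with m≤n⇒∃[o]m+o≡n 3≤ℓ | m≤n⇒∃[o]m+o≡n ℓ<n
... | a , refl | b , refl = ≤-trans (m≤m+n _ _) (≤-reflexive (slack a b))
  where
  slack : ∀ a b → let ℓ = 3 + a ; n = suc ℓ + b in
    n + suc n * (2 + ℓ) + (7 + 10 * a + 3 * b + 2 * a * a + 2 * a * b) ≡ ℓ * (3 * n)
  slack = solve-∀

Ndim-lower : ∀ ℓ {n} → 2 ^ ℓ ≤ n → ℓ * (3 * n) ≤ Ndim n
Ndim-lower ℓ {n} 2^ℓ≤n = begin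
  ℓ * (3 * n)               ≡⟨ ⌈log₂2^n⌉≡n (ℓ * (3 * n)) ⟨
  ⌈log₂ 2 ^ (ℓ * (3 * n)) ⌉ ≡⟨ cong ⌈log₂_⌉ (^-*-assoc 2 ℓ (3 * n)) ⟨
  ⌈log₂ (2 ^ ℓ) ^ (3 * n) ⌉ ≤⟨ ⌈log₂⌉-mono-≤ (^-monoˡ-≤ (3 * n) 2^ℓ≤n) ⟩
  ⌈log₂ n ^ (3 * n) ⌉       ∎
  where open ≤-Reasoning

-- m = ⌊log₂ n⌋ + 2: then 2^m ≥ n + k, while n + (n + 1) m still fits into 3 n ⌊log₂ n⌋ ≤ N.
parameters : ∀ k n → 8 + k ≤ n → ∃ λ m → suc k * 2 ^ n ≤ 2 ^ 2 ^ m × n + suc n * m ≤ Ndim n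
parameters k n 8+k≤n with binary-magnitude n (≤-trans (s≤s z≤n) 8+k≤n)
... | ℓ , 2^ℓ≤n , n<2^1+ℓ = 2 + ℓ , budget , fits
  where
  open ≤-Reasoning
  3≤ℓ : 3 ≤ ℓ
  3≤ℓ = ≮⇒≥ λ ℓ<3 → <⇒≱ n<2^1+ℓ (≤-trans (^-monoʳ-≤ 2 ℓ<3) (≤-trans (m≤m+n 8 k) 8+k≤n))
  k+n≤2^[2+ℓ] : k + n ≤ 2 ^ (2 + ℓ)
  k+n≤2^[2+ℓ] = begin
    k + n                       ≤⟨ +-mono-≤ (≤-trans (m≤n+m k 8) 8+k≤n) ≤-refl ⟩
    n + n                       ≤⟨ +-mono-≤ (<⇒≤ n<2^1+ℓ) (<⇒≤ n<2^1+ℓ) ⟩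
    2 ^ suc ℓ + 2 ^ suc ℓ       ≡⟨ cong (2 ^ suc ℓ +_) (+-identityʳ (2 ^ suc ℓ)) ⟨
    2 ^ (2 + ℓ)                 ∎
  budget : suc k * 2 ^ n ≤ 2 ^ 2 ^ (2 + ℓ)
  budget = begin
    suc k * 2 ^ n      ≤⟨ *-monoˡ-≤ (2 ^ n) (n<2^n k) ⟩
    2 ^ k * 2 ^ n      ≡⟨ ^-distribˡ-+-* 2 k n ⟨
    2 ^ (k + n)        ≤⟨ ^-monoʳ-≤ 2 k+n≤2^[2+ℓ] ⟩
    2 ^ 2 ^ (2 + ℓ)    ∎
  fits : n + suc n * (2 + ℓ) ≤ Ndim n
  fits = ≤-trans (dimension-budget 3≤ℓ (≤-trans (n<2^n ℓ) 2^ℓ≤n)) (Ndim-lower ℓ 2^ℓ≤n)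

MonoCopiesAbundant : (k n N : ℕ) → Set
MonoCopiesAbundant k n N = Σ (List (Coloring N)) λ L →
  AllPairs Differ L × All (HasMonoCopy n) L × suc k * length L ≥ k * 2 ^ 2 ^ N

abundant : ∀ k n m pad → suc k * 2 ^ n ≤ 2 ^ 2 ^ m → MonoCopiesAbundant k n (n + blocks m pad (suc n))
abundant k n m pad budget =
  L , hittingEach-distinct n φ ,
  All.map (λ {c} → HitsEach⇒HasMonoCopy ψ (ladder-ascending m pad (suc n)) c) (hittingEach-hits n φ) ,
  fraction-bound k (2 ^ n) (2 ^ 2 ^ m) _ (length L) {{m^n≢0 2 (2 ^ m)}} budget
    (length-hittingEach n φ λ x → dim-ladder m pad (suc n) (s≤s (∣p∣≤n x)))
  where
  ψ = ladder m pad (suc n)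
  φ = ψ ∘ ∣_∣
  L = hittingEach n φ

theorem1 : (k : ℕ) → Σ ℕ λ n₀ → (n : ℕ) → n ≥ n₀ →
    Σ (List (Coloring (Ndim n))) λ L →
      AllPairs Differ L × All (HasMonoCopy n) L ×
      suc k * length L ≥ k * 2 ^ (2 ^ Ndim n)
theorem1 k = 8 + k , λ n 8+k≤n →
  let m , budget , fits = parameters k n 8+k≤n
      pad = Ndim n ∸ (n + suc n * m)
      dimension : n + blocks m pad (suc n) ≡ Ndim n
      dimension = begin
        n + blocks m pad (suc n)   ≡⟨ cong (n +_) (blocks≡ m pad (suc n)) ⟩
        n + (suc n * m + pad)      ≡⟨ +-assoc n (suc n * m) pad ⟨
        n + suc n * m + pad        ≡⟨ m+[n∸m]≡n fits ⟩
        Ndim n                     ∎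
  in subst (MonoCopiesAbundant k n) dimension (abundant k n m pad budget)
  where open ≡-Reasoning
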